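{- Let $k,\lambda$ be positive integers, let $\mu=k-\lambda$, and let $\mathcal{H}$ be a $\lambda$-intersecting $k$-graph with $m \geq 20\mu$ edges that is not a sunflower. If $\mathcal{H}$ has fewer than $\lambda$ heavy vertices, then $m \leq 2\mu^2$. Otherwise, $m \leq 3 \lambda \mu$.
   Context: A $k$-graph is a $k$-uniform hypergraph (edges are distinct $k$-element sets). A hypergraph is $\lambda$-intersecting if every pair of distinct edges shares exactly $\lambda$ vertices. A hypergraph $\mathcal{H}$ is a sunflower if $e_1\cap e_2=\bigcap_{e\in E(\mathcal{H})} e$ for all distinct edges $e_1,e_2$. For a $\lambda$-intersecting $k$-graph with $m\ge 20\mu$ edges, a vertex $v$ is called heavy if its degree (number of edges containing it) satisfies $d(v)\geq m-1.1\mu$. -}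

module Defs where

open import Data.Nat using (ℕ; _+_; _*_; _∸_; _≤_; _≤?_)
open import Data.Fin using (Fin)
open import Data.Fin.Subset using (Subset; _∩_; ⋂; ∣_∣; _∈_)
open import Data.Fin.Subset.Properties using (_∈?_)
open import Data.List using (List; length; filter; map; allFin)
open import Relation.Binary.PropositionalEquality using (_≡_; _≢_)
open import Function.Definitions using (Injective)

Hypergraph : ℕ → ℕ → Set
Hypergraph n m = Fin m → Subset n

DistinctEdges : ∀ {n m} → Hypergraph n m → Set
DistinctEdges E = Injective _≡_ _≡_ E

Uniform : ∀ {n m} → ℕ → Hypergraph n m → Set
Uniform k E = ∀ i → ∣ E i ∣ ≡ k

Intersecting : ∀ {n m} → ℕ → Hypergraph n m → Set
Intersecting l E = ∀ i j → i ≢ j → ∣ E i ∩ E j ∣ ≡ l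

IsKGraph : ∀ {n m} → ℕ → Hypergraph n m → Set
IsKGraph k E = DistinctEdges E Data.Product.× Uniform k E
  where import Data.Product

kernel : ∀ {n m} → Hypergraph n m → Subset n
kernel {m = m} E = ⋂ (map E (allFin m))

IsSunflower : ∀ {n m} → Hypergraph n m → Set
IsSunflower E = ∀ i j → i ≢ j → E i ∩ E j ≡ kernel E

degree : ∀ {n m} → Hypergraph n m → Fin n → ℕ
degree {m = m} E v = length (filter (λ i → v ∈? E i) (allFin m))

-- heavy: d(v) ≥ m − 1.1μ, written over ℕ as 10·m ≤ 10·d(v) + 11·μ
Heavy : ∀ {n m} → ℕ → Hypergraph n m → Fin n → Set
Heavy {m = m} μ E v = 10 * m ≤ 10 * degree E v + 11 * μ

numHeavy : ∀ {n m} → ℕ → Hypergraph n m → ℕ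
numHeavy {n} {m} μ E = length (filter (λ v → 10 * m ≤? 10 * degree E v + 11 * μ) (allFin n))

{-# OPTIONS --safe #-}
-- Identify each edge with its incidence vector e i. Being λ-intersecting and k-uniform means
-- ⟨e i , e j⟩ = λ + μ [i = j], so for weights α, β on the edges the loads ∑ α i e i obey the Gram
-- identity ⟨∑ α i e i , ∑ β j e j⟩ = λ (∑ α) (∑ β) + μ ⟨α , β⟩.  Applied to the edges through a
-- vertex v and the edges missing v, it yields d(v) (m − d(v)) ≤ μ m, so for m ≥ 20 μ every vertex
-- that is not heavy has degree at most 1.1 μ.  The degrees along any edge sum to λ m + μ.  With
-- fewer than λ heavy vertices an edge contains at least μ + 1 light ones, and this sum forces
-- m ≤ 2 μ².  With at least λ heavy vertices and m > 3 λ μ, the same count shows that there are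
-- exactly λ heavy vertices and that at least m − 1.1 λ μ edges contain all of them; the Gram
-- identity for these full edges puts every light vertex in at most one of them, which rules out
-- any edge that is not full.  Then all pairwise intersections equal the heavy set: a sunflower.
module Submission where

open import Defs
open import Data.Nat using (ℕ; zero; suc; _+_; _*_; _∸_; _≤_; _<_; _≰_; _≤?_; z≤n; s≤s; NonZero; >-nonZero⁻¹)
open import Data.Nat.Properties
open import Data.Nat.Tactic.RingSolver using (solve-∀)
open import Data.Bool using (true; false; if_then_else_)
open import Data.Empty using (⊥; ⊥-elim)
open import Data.Sum using (inj₁; inj₂; [_,_]′)
open import Data.Fin using (Fin; zero; suc)
open import Data.Fin.Properties using () renaming (_≟_ to _≟ᶠ_)
open import Data.Fin.Subset using (Subset; _∩_; ∁; ⋂; ∣_∣; _∈_; _∉_; _⊆_)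
open import Data.Fin.Subset.Properties
  using (_∈?_; x∈p∩q⁺; x∈p∩q⁻; x∈p⇒x∉∁p; x∉p⇒x∈∁p; ∈⊤;
         ⊆-antisym; p⊂q⇒∣p∣<∣q∣; p∩q⊆p; p∩q⊆q; ∩-idem; ∣p∩q∣≤∣p∣; ∣p∩q∣≤∣q∣; _⊆?_)
open import Data.List using (List; []; _∷_; length; filter; map; tabulate; allFin)
open import Data.List.Relation.Unary.All using (All; []; _∷_)
import Data.List.Relation.Unary.All.Properties as All
import Data.Vec as Vec
open import Data.Vec.Properties using (lookup∘tabulate; lookup⇒[]=; []=⇒lookup)
open import Data.Product using (_×_; _,_; proj₁; proj₂; ∃₂)
open import Function using (_∘_; _⇔_; mk⇔)
open import Relation.Binary.PropositionalEquality
open import Relation.Nullary using (¬_; Dec; yes; no; does; contradiction)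
open import Relation.Nullary.Decidable using (dec-true; dec-false; does-⇔; toSum)
open import Relation.Unary using (Pred; Decidable)

open import Algebra.Properties.Semiring.Sum +-*-semiring
  using (sum; sum-syntax; sum-cong-≗; ∑-distrib-+; ∑-comm; *-distribˡ-sum; *-distribʳ-sum)

2*m*n≤m*m+n*n : ∀ m n → 2 * (m * n) ≤ m * m + n * n
2*m*n≤m*m+n*n m n = [ ordered , (λ n≤m → subst₂ _≤_ (cong (2 *_) (*-comm n m)) (+-comm (n * n) (m * m)) (ordered n≤m)) ]′
                      (≤-total m n)
  where
  ordered : ∀ {m n} → m ≤ n → 2 * (m * n) ≤ m * m + n * n
  ordered {m} m≤n with m≤n⇒∃[o]m+o≡n m≤n
  ... | k , refl = subst (2 * (m * (m + k)) ≤_) (square m k) (m≤m+n _ (k * k))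
    where
    square : ∀ m k → 2 * (m * (m + k)) + k * k ≡ m * m + (m + k) * (m + k)
    square = solve-∀

m*m≤n*m⇒m≤n : ∀ m n → m * m ≤ n * m → m ≤ n
m*m≤n*m⇒m≤n zero    n _   = z≤n
m*m≤n*m⇒m≤n (suc m) n le = *-cancelʳ-≤ (suc m) n (suc m) le

n≤n*n : ∀ n → n ≤ n * n
n≤n*n zero    = z≤n
n≤n*n (suc n) = m≤m*n (suc n) (suc n)

n≡n*n⇒n≤1 : ∀ n → n ≡ n * n → n ≤ 1
n≡n*n⇒n≤1 zero          _    = z≤n
n≡n*n⇒n≤1 (suc zero)    _    = ≤-refl
n≡n*n⇒n≤1 (suc (suc n)) n≡n² = contradiction n≡n² (<⇒≢ (m<m*n (suc (suc n)) (suc (suc n)) (s≤s (s≤s z≤n))))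

a*[x+y]≤x*y+a*a : ∀ a x y → a ≤ x → a ≤ y → a * (x + y) ≤ x * y + a * a
a*[x+y]≤x*y+a*a a x y a≤x a≤y with m≤n⇒∃[o]m+o≡n a≤x | m≤n⇒∃[o]m+o≡n a≤y
... | i , refl | j , refl = subst (a * ((a + i) + (a + j)) ≤_) (expand a i j) (m≤m+n _ (i * j))
  where
  expand : ∀ a i j → a * ((a + i) + (a + j)) + i * j ≡ (a + i) * (a + j) + a * a
  expand = solve-∀

a*b≤μ*[a+b] : ∀ l μ a b →
  2 * (b * a) * (l * (a * b)) + (b * a) * (b * a) ≤ (b * b) * (l * (a * a) + μ * a) + (a * a) * (l * (b * b) + μ * b) →
  a * b ≤ μ * (a + b)
a*b≤μ*[a+b] l μ a b le = m*m≤n*m⇒m≤n (a * b) (μ * (a + b))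
  (+-cancelˡ-≤ (2 * l * ((a * b) * (a * b))) _ _ (subst₂ _≤_ (lhs l a b) (rhs l μ a b) le))
  where
  lhs : ∀ l a b → 2 * (b * a) * (l * (a * b)) + (b * a) * (b * a) ≡ 2 * l * ((a * b) * (a * b)) + (a * b) * (a * b)
  lhs = solve-∀
  rhs : ∀ l μ a b → (b * b) * (l * (a * a) + μ * a) + (a * a) * (l * (b * b) + μ * b)
                  ≡ 2 * l * ((a * b) * (a * b)) + μ * (a + b) * (a * b)
  rhs = solve-∀

-- If 10 d and 10 d̄ both exceeded 11 μ, then (10 d − A)(10 d̄ − A) ≥ 0 for A = 11 μ + 1 would give
-- 10 (μ + 1) m ≤ A², which fails once m ≥ 20 μ.
light-degree-bound : ∀ μ m d d̄ → d + d̄ ≡ m → d * d̄ ≤ μ * m → 20 * μ ≤ m → 10 * d + 11 * μ < 10 * m →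
                     10 * d ≤ 11 * μ
light-degree-bound μ m d d̄ d+d̄≡m dd̄≤μm 20μ≤m light with 10 * d ≤? 11 * μ
... | yes 10d≤11μ = 10d≤11μ
... | no  10d≰11μ = ⊥-elim (<-irrefl refl (begin-strict
  A * A                                          <⟨ m<m+n (A * A) (s≤s z≤n) ⟩
  A * A + suc (79 * (μ * μ) + 78 * μ + 3)        ≡⟨ expand μ ⟩
  10 * (μ * (20 * μ)) + (5 * (20 * μ) + 5 * 1)   ≤⟨ +-mono-≤ (*-monoʳ-≤ 10 (*-monoʳ-≤ μ 20μ≤m))
                                                               (+-mono-≤ (*-monoʳ-≤ 5 20μ≤m) (*-monoʳ-≤ 5 1≤m)) ⟩
  10 * (μ * m) + (5 * m + 5 * m)                 ≤⟨ +-cancelˡ-≤ (100 * (μ * m)) _ _ (begin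
      100 * (μ * m) + (10 * (μ * m) + (5 * m + 5 * m)) ≡⟨ collect μ m ⟩
      A * (10 * m)                                     ≡⟨ cong (λ k → A * (10 * k)) d+d̄≡m ⟨
      A * (10 * (d + d̄))                               ≡⟨ cong (A *_) (*-distribˡ-+ 10 d d̄) ⟩
      A * (10 * d + 10 * d̄)                            ≤⟨ a*[x+y]≤x*y+a*a A (10 * d) (10 * d̄) A≤10d A≤10d̄ ⟩
      10 * d * (10 * d̄) + A * A                        ≡⟨ cong (_+ A * A) (ten-squared d d̄) ⟩
      100 * (d * d̄) + A * A                            ≤⟨ +-monoˡ-≤ (A * A) (*-monoʳ-≤ 100 dd̄≤μm) ⟩
      100 * (μ * m) + A * A                            ∎) ⟩
  A * A                                          ∎))
  where
  open ≤-Reasoning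
  A : ℕ
  A = suc (11 * μ)
  A≤10d : A ≤ 10 * d
  A≤10d = ≰⇒> 10d≰11μ
  A≤10d̄ : A ≤ 10 * d̄
  A≤10d̄ = +-cancelˡ-≤ (10 * d) _ _ (begin
    10 * d + A        ≡⟨ +-suc (10 * d) (11 * μ) ⟩
    suc (10 * d + 11 * μ) ≤⟨ light ⟩
    10 * m            ≡⟨ cong (10 *_) d+d̄≡m ⟨
    10 * (d + d̄)      ≡⟨ *-distribˡ-+ 10 d d̄ ⟩
    10 * d + 10 * d̄   ∎)
  1≤m : 1 ≤ m
  1≤m = positive (≤-<-trans z≤n light)
    where
    positive : ∀ {k} → 0 < 10 * k → 1 ≤ k
    positive {suc _} _ = s≤s z≤n
  expand : ∀ μ → suc (11 * μ) * suc (11 * μ) + suc (79 * (μ * μ) + 78 * μ + 3) ≡ 10 * (μ * (20 * μ)) + (5 * (20 * μ) + 5 * 1)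
  expand = solve-∀
  collect : ∀ μ m → 100 * (μ * m) + (10 * (μ * m) + (5 * m + 5 * m)) ≡ suc (11 * μ) * (10 * m)
  collect = solve-∀
  ten-squared : ∀ d d̄ → 10 * d * (10 * d̄) ≡ 100 * (d * d̄)
  ten-squared = solve-∀

l*t≤t*c+c'⇒t≤c' : ∀ l t c c' → l * t ≤ t * c + c' → c < l → t ≤ c'
l*t≤t*c+c'⇒t≤c' l t c c' l*t≤ c<l = +-cancelˡ-≤ (t * c) t c' (begin
  t * c + t    ≡⟨ regroup t c ⟩
  suc c * t    ≤⟨ *-monoˡ-≤ t c<l ⟩
  l * t        ≤⟨ l*t≤ ⟩
  t * c + c'   ∎)
  where
  open ≤-Reasoning
  regroup : ∀ t c → t * c + t ≡ suc c * t
  regroup = solve-∀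

full-edges-bound : ∀ m l S t μ → 10 * m * l ≤ 10 * S + 11 * μ * l → m + S ≤ m * l + t →
                   10 * m ≤ 10 * t + 11 * μ * l
full-edges-bound m l S t μ heavy-sum S-bound = +-cancelˡ-≤ (10 * (m * l)) _ _ (begin
  10 * (m * l) + 10 * m           ≡⟨ regroup₁ m l ⟩
  10 * m * l + 10 * m             ≤⟨ +-monoˡ-≤ (10 * m) heavy-sum ⟩
  10 * S + 11 * μ * l + 10 * m    ≡⟨ regroup₂ m S (11 * μ * l) ⟩
  10 * (m + S) + 11 * μ * l       ≤⟨ +-monoˡ-≤ (11 * μ * l) (*-monoʳ-≤ 10 S-bound) ⟩
  10 * (m * l + t) + 11 * μ * l   ≡⟨ regroup₃ (m * l) t (11 * μ * l) ⟩
  10 * (m * l) + (10 * t + 11 * μ * l) ∎)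
  where
  open ≤-Reasoning
  regroup₁ : ∀ m l → 10 * (m * l) + 10 * m ≡ 10 * m * l + 10 * m
  regroup₁ = solve-∀
  regroup₂ : ∀ m S r → 10 * S + r + 10 * m ≡ 10 * (m + S) + r
  regroup₂ = solve-∀
  regroup₃ : ∀ p t r → 10 * (p + t) + r ≡ 10 * p + (10 * t + r)
  regroup₃ = solve-∀

-- The remaining inequalities are checked by substituting witnesses for the strict hypotheses;
-- the ring solver then exhibits the excess of one side over the other as a polynomial with
-- nonnegative coefficients.  Each identity is stated in exactly the shape the substitution
-- produces (suc versus 1 +), since comparing two different forms makes Agda unfold the products.
≤-excess⇒⊥ : ∀ {a b} e → a ≤ b → a ≡ b + suc e → ⊥
≤-excess⇒⊥ {b = b} e a≤b a≡b+1+e = m+1+n≰m b (subst (_≤ b) a≡b+1+e a≤b)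

suc-+-regroup : ∀ a b c → suc a + b + c ≡ a + (suc b + c)
suc-+-regroup a b c = trans (+-assoc (suc a) b c) (sym (+-suc a (b + c)))

few-heavy-bound : ∀ c c' l μ m → c + c' ≡ l + μ → c < l → 1 ≤ μ →
                  10 * (l * m + μ) ≤ 10 * m * c + 11 * μ * c' → m ≤ 2 * (μ * μ)
few-heavy-bound c c' l μ m c+c'≡l+μ c<l 1≤μ bound with m ≤? 2 * (μ * μ)
... | yes m≤2μ² = m≤2μ²
... | no  m≰2μ² with m≤n⇒∃[o]m+o≡n c<l | m≤n⇒∃[o]m+o≡n 1≤μ | m≤n⇒∃[o]m+o≡n (≰⇒> m≰2μ²)
... | s , refl | u , refl | z , refl with +-cancelˡ-≡ c c' (suc s + μ) (trans c+c'≡l+μ (suc-+-regroup c s μ))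
...   | refl = ⊥-elim (≤-excess⇒⊥ _ bound (excess c s z u))
  where
  excess : ∀ c s z u → 10 * ((suc c + s) * (suc (2 * ((1 + u) * (1 + u))) + z) + (1 + u))
                     ≡ 10 * (suc (2 * ((1 + u) * (1 + u))) + z) * c + 11 * (1 + u) * (suc s + (1 + u))
                       + suc (17 + 19 * s + 29 * (s * u) + 20 * (s * u * u) + 10 * (s * z) + 17 * u + 9 * (u * u) + 10 * z)
  excess = solve-∀

heavy-per-edge-bound : ∀ c c' l μ m → c + c' ≡ l + μ → 1 ≤ l → 3 * (l * μ) < m →
                       10 * m * c + 10 * c' ≤ 10 * (l * m + μ) + 11 * μ * c → c ≤ l
heavy-per-edge-bound c c' l μ m c+c'≡l+μ 1≤l 3lμ<m bound with c ≤? l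
... | yes c≤l = c≤l
... | no  c≰l with m≤n⇒∃[o]m+o≡n 1≤l | m≤n⇒∃[o]m+o≡n (≰⇒> c≰l)
... | l' , refl | s , refl with +-cancelˡ-≡ (1 + l') μ (suc s + c') (trans (sym c+c'≡l+μ) (suc-+-regroup (1 + l') s c'))
...   | refl with m≤n⇒∃[o]m+o≡n 3lμ<m
...     | z , refl = ⊥-elim (≤-excess⇒⊥ _ bound (excess l' s c' z))
  where
  excess : ∀ l' s c' z → 10 * (suc (3 * ((1 + l') * (suc s + c'))) + z) * (suc (1 + l') + s) + 10 * c'
                       ≡ 10 * ((1 + l') * (suc (3 * ((1 + l') * (suc s + c'))) + z) + (suc s + c'))
                         + 11 * (suc s + c') * (suc (1 + l') + s)
                         + suc (7 + 8 * c' + 19 * (c' * l') + 30 * (c' * l' * s) + 19 * (c' * s) + 19 * l' + 49 * (l' * s)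
                                + 30 * (l' * s * s) + 27 * s + 19 * (s * s) + 10 * (s * z) + 10 * z)
  excess = solve-∀

heavy-count-bound : ∀ h l μ m S → S ≤ m * l → 10 * m * h ≤ 10 * S + 11 * μ * h → 3 * (l * μ) < m → 1 ≤ l → h ≤ l
heavy-count-bound h l μ m S S≤ml bound 3lμ<m 1≤l with h ≤? l
... | yes h≤l = h≤l
... | no  h≰l with m≤n⇒∃[o]m+o≡n 1≤l | m≤n⇒∃[o]m+o≡n (≰⇒> h≰l)
... | l' , refl | s , refl with m≤n⇒∃[o]m+o≡n 3lμ<m
...   | z , refl = ⊥-elim (≤-excess⇒⊥ _ (≤-trans bound (+-monoˡ-≤ _ (*-monoʳ-≤ 10 S≤ml))) (excess l' s μ z))
  where
  excess : ∀ l' s μ z → 10 * (suc (3 * ((1 + l') * μ)) + z) * (suc (1 + l') + s)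
                      ≡ 10 * ((suc (3 * ((1 + l') * μ)) + z) * (1 + l')) + 11 * μ * (suc (1 + l') + s)
                        + suc (9 + 30 * (l' * s * μ) + 19 * (l' * μ) + 10 * s + 10 * (s * z) + 19 * (s * μ) + 10 * z + 8 * μ)
  excess = solve-∀

full-edges-absurd : ∀ l μ m t → 10 * m ≤ 10 * t + 11 * μ * l → t ≤ l + μ → 3 * (l * μ) < m → 1 ≤ l → 1 ≤ μ → ⊥
full-edges-absurd l μ m t bound t≤l+μ 3lμ<m 1≤l 1≤μ with m≤n⇒∃[o]m+o≡n 1≤l | m≤n⇒∃[o]m+o≡n 1≤μ
... | l' , refl | u , refl with m≤n⇒∃[o]m+o≡n 3lμ<m
...   | z , refl = ≤-excess⇒⊥ _ (≤-trans bound (+-monoˡ-≤ _ (*-monoʳ-≤ 10 t≤l+μ))) (excess l' u z)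
  where
  excess : ∀ l' u z → 10 * (suc (3 * ((1 + l') * (1 + u))) + z)
                    ≡ 10 * ((1 + l') + (1 + u)) + 11 * (1 + u) * (1 + l') + suc (8 + 9 * l' + 9 * u + 19 * (l' * u) + 10 * z)
  excess = solve-∀

∑-mono-≤ : ∀ {n} {f g : Fin n → ℕ} → (∀ i → f i ≤ g i) → sum f ≤ sum g
∑-mono-≤ {zero}  f≤g = z≤n
∑-mono-≤ {suc n} f≤g = +-mono-≤ (f≤g zero) (∑-mono-≤ (f≤g ∘ suc))

∑-mono-≤-excess : ∀ {n} {f g : Fin n → ℕ} {e} → (∀ i → f i ≤ g i) →
                  ∀ i → f i + e ≤ g i → sum f + e ≤ sum g
∑-mono-≤-excess {suc n} {f} {g} {e} f≤g zero fᵢ+e≤gᵢ = begin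
  f zero + sum (f ∘ suc) + e   ≡⟨ +-assoc (f zero) _ e ⟩
  f zero + (sum (f ∘ suc) + e) ≡⟨ cong (f zero +_) (+-comm _ e) ⟩
  f zero + (e + sum (f ∘ suc)) ≡⟨ +-assoc (f zero) e _ ⟨
  f zero + e + sum (f ∘ suc)   ≤⟨ +-mono-≤ fᵢ+e≤gᵢ (∑-mono-≤ (f≤g ∘ suc)) ⟩
  g zero + sum (g ∘ suc)       ∎
  where open ≤-Reasoning
∑-mono-≤-excess {suc n} {f} {g} {e} f≤g (suc i) fᵢ+e≤gᵢ = begin
  f zero + sum (f ∘ suc) + e   ≡⟨ +-assoc (f zero) _ e ⟩
  f zero + (sum (f ∘ suc) + e) ≤⟨ +-mono-≤ (f≤g zero) (∑-mono-≤-excess (f≤g ∘ suc) i fᵢ+e≤gᵢ) ⟩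
  g zero + sum (g ∘ suc)       ∎
  where open ≤-Reasoning

∑-tight : ∀ {n} {f g : Fin n → ℕ} → (∀ i → f i ≤ g i) → sum g ≤ sum f → ∀ i → f i ≡ g i
∑-tight {f = f} {g} f≤g ∑g≤∑f i with m≤n⇒m<n∨m≡n (f≤g i)
... | inj₂ fᵢ≡gᵢ = fᵢ≡gᵢ
... | inj₁ fᵢ<gᵢ = contradiction (≤-trans (∑-mono-≤-excess f≤g i (≤-trans (≤-reflexive (+-comm (f i) 1)) fᵢ<gᵢ)) ∑g≤∑f)
                                 (m+1+n≰m (sum f))

term≤∑ : ∀ {n} (f : Fin n → ℕ) i → f i ≤ sum f
term≤∑ f zero    = m≤m+n (f zero) _
term≤∑ f (suc i) = ≤-trans (term≤∑ (f ∘ suc) i) (m≤n+m _ (f zero))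

∑-const : ∀ {n} c → sum {n} (λ _ → c) ≡ n * c
∑-const {zero}  c = refl
∑-const {suc n} c = cong (c +_) (∑-const {n} c)

𝟙 : ∀ {a} {A : Set a} → Dec A → ℕ
𝟙 a? = if does a? then 1 else 0

module _ {a} {A : Set a} (a? : Dec A) where

  𝟙-yes : A → 𝟙 a? ≡ 1
  𝟙-yes x = cong (λ b → if b then 1 else 0) (dec-true a? x)

  𝟙-no : ¬ A → 𝟙 a? ≡ 0
  𝟙-no ¬x = cong (λ b → if b then 1 else 0) (dec-false a? ¬x)

  𝟙-idem : 𝟙 a? * 𝟙 a? ≡ 𝟙 a?
  𝟙-idem with does a?
  ... | true  = refl
  ... | false = refl

𝟙-cong : ∀ {a b} {A : Set a} {B : Set b} (a? : Dec A) (b? : Dec B) → A ⇔ B → 𝟙 a? ≡ 𝟙 b?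
𝟙-cong a? b? A⇔B = cong (λ b → if b then 1 else 0) (does-⇔ A⇔B a? b?)

∑-δ : ∀ {n} (j : Fin n) (f : Fin n → ℕ) → ∑[ i < n ] (𝟙 (i ≟ᶠ j) * f i) ≡ f j
∑-δ {suc n} zero    f = trans (cong₂ _+_ (+-identityʳ (f zero)) (trans (∑-const {n} 0) (*-zeroʳ n)))
                              (+-identityʳ (f zero))
∑-δ {suc n} (suc j) f = ∑-δ j (f ∘ suc)

length-filter-tabulate : ∀ {a p} {A : Set a} {P : Pred A p} (P? : Decidable P) {n} (f : Fin n → A) →
                         length (filter P? (tabulate f)) ≡ ∑[ i < n ] 𝟙 (P? (f i))
length-filter-tabulate P? {zero}  f = refl
length-filter-tabulate P? {suc n} f with does (P? (f zero))
... | true  = cong suc (length-filter-tabulate P? (f ∘ suc))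
... | false = length-filter-tabulate P? (f ∘ suc)

⟨_,_⟩ : ∀ {n} → (Fin n → ℕ) → (Fin n → ℕ) → ℕ
⟨ f , g ⟩ = sum (λ x → f x * g x)

⟨⟩-comm : ∀ {n} (f g : Fin n → ℕ) → ⟨ f , g ⟩ ≡ ⟨ g , f ⟩
⟨⟩-comm f g = sum-cong-≗ (λ x → *-comm (f x) (g x))

⟨,*⟩ : ∀ {n} a (f g : Fin n → ℕ) → ⟨ f , (λ x → a * g x) ⟩ ≡ a * ⟨ f , g ⟩
⟨,*⟩ a f g = trans (sum-cong-≗ (λ x → x*[a*y]≡a*[x*y] (f x) a (g x))) (sym (*-distribˡ-sum a (λ x → f x * g x)))
  where
  x*[a*y]≡a*[x*y] : ∀ x a y → x * (a * y) ≡ a * (x * y)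
  x*[a*y]≡a*[x*y] = solve-∀

⟨,+⟩ : ∀ {n} (f g h : Fin n → ℕ) → ⟨ f , (λ x → g x + h x) ⟩ ≡ ⟨ f , g ⟩ + ⟨ f , h ⟩
⟨,+⟩ f g h = trans (sum-cong-≗ (λ x → *-distribˡ-+ (f x) (g x) (h x))) (∑-distrib-+ (λ x → f x * g x) (λ x → f x * h x))

-- ‖a f − b g‖² ≥ (a f v − b g v)², written without subtraction.
⟨⟩-cross-term : ∀ {n} a b (f g : Fin n → ℕ) v → g v ≡ 0 →
                2 * (a * b) * ⟨ f , g ⟩ + (a * f v) * (a * f v) ≤ (a * a) * ⟨ f , f ⟩ + (b * b) * ⟨ g , g ⟩
⟨⟩-cross-term a b f g v gᵥ≡0 = begin
  2 * (a * b) * ⟨ f , g ⟩ + X v * X v             ≡⟨ cong (_+ X v * X v) (trans (*-distribˡ-sum (2 * (a * b)) (λ x → f x * g x))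
                                                        (sum-cong-≗ (λ x → scale-cross a b (f x) (g x)))) ⟩
  sum (λ x → 2 * (X x * Y x)) + X v * X v         ≤⟨ ∑-mono-≤-excess (λ x → 2*m*n≤m*m+n*n (X x) (Y x)) v at-v ⟩
  sum (λ x → X x * X x + Y x * Y x)               ≡⟨ ∑-distrib-+ (λ x → X x * X x) (λ x → Y x * Y x) ⟩
  sum (λ x → X x * X x) + sum (λ x → Y x * Y x)   ≡⟨ cong₂ _+_ (scale-square a f) (scale-square b g) ⟩
  (a * a) * ⟨ f , f ⟩ + (b * b) * ⟨ g , g ⟩       ∎
  where
  open ≤-Reasoning
  X Y : _ → ℕ
  X x = a * f x
  Y x = b * g x
  scale-cross : ∀ a b u w → 2 * (a * b) * (u * w) ≡ 2 * ((a * u) * (b * w))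
  scale-cross = solve-∀
  scale-square : ∀ c (h : _ → ℕ) → sum (λ x → (c * h x) * (c * h x)) ≡ (c * c) * ⟨ h , h ⟩
  scale-square c h = trans (sum-cong-≗ (λ x → shuffle c (h x))) (sym (*-distribˡ-sum (c * c) (λ x → h x * h x)))
    where
    shuffle : ∀ c u → (c * u) * (c * u) ≡ (c * c) * (u * u)
    shuffle = solve-∀
  at-v : 2 * (X v * Y v) + X v * X v ≤ X v * X v + Y v * Y v
  at-v rewrite gᵥ≡0 | *-zeroʳ b | *-zeroʳ (X v) = m≤m+n (X v * X v) 0

module Gram {n m} (l μ : ℕ) (e : Fin m → Fin n → ℕ)
            (⟨e,e⟩ : ∀ i j → ⟨ e i , e j ⟩ ≡ l + 𝟙 (i ≟ᶠ j) * μ) where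

  load : (Fin m → ℕ) → Fin n → ℕ
  load α x = ∑[ i < m ] (α i * e i x)

  ⟨load,⟩ : ∀ α g → ⟨ load α , g ⟩ ≡ ∑[ i < m ] (α i * ⟨ e i , g ⟩)
  ⟨load,⟩ α g = begin
    sum (λ x → load α x * g x)                 ≡⟨ sum-cong-≗ (λ x → *-distribʳ-sum (g x) (λ i → α i * e i x)) ⟩
    sum (λ x → sum (λ i → α i * e i x * g x))  ≡⟨ ∑-comm (λ x i → α i * e i x * g x) ⟩
    sum (λ i → sum (λ x → α i * e i x * g x))  ≡⟨ sum-cong-≗ (λ i → trans (sum-cong-≗ (λ x → *-assoc (α i) (e i x) (g x)))
                                                                         (sym (*-distribˡ-sum (α i) (λ x → e i x * g x)))) ⟩
    sum (λ i → α i * ⟨ e i , g ⟩)              ∎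
    where open ≡-Reasoning

  sum-load : ∀ α → sum (load α) ≡ ∑[ i < m ] (α i * sum (e i))
  sum-load α = begin
    sum (load α)                        ≡⟨ sum-cong-≗ (λ x → *-identityʳ (load α x)) ⟨
    ⟨ load α , (λ _ → 1) ⟩              ≡⟨ ⟨load,⟩ α (λ _ → 1) ⟩
    sum (λ i → α i * ⟨ e i , (λ _ → 1) ⟩) ≡⟨ sum-cong-≗ (λ i → cong (α i *_) (sum-cong-≗ (λ x → *-identityʳ (e i x)))) ⟩
    sum (λ i → α i * sum (e i))         ∎
    where open ≡-Reasoning

  ⟨e,load⟩ : ∀ j β → ⟨ e j , load β ⟩ ≡ l * sum β + μ * β j
  ⟨e,load⟩ j β = begin
    ⟨ e j , load β ⟩                                      ≡⟨ ⟨⟩-comm (e j) (load β) ⟩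
    ⟨ load β , e j ⟩                                      ≡⟨ ⟨load,⟩ β (e j) ⟩
    sum (λ i → β i * ⟨ e i , e j ⟩)                       ≡⟨ sum-cong-≗ (λ i → trans (cong (β i *_) (⟨e,e⟩ i j))
                                                                                   (spread (β i) (𝟙 (i ≟ᶠ j)))) ⟩
    sum (λ i → l * β i + μ * (𝟙 (i ≟ᶠ j) * β i))          ≡⟨ ∑-distrib-+ (λ i → l * β i) (λ i → μ * (𝟙 (i ≟ᶠ j) * β i)) ⟩
    sum (λ i → l * β i) + sum (λ i → μ * (𝟙 (i ≟ᶠ j) * β i))
                                                          ≡⟨ cong₂ _+_ (*-distribˡ-sum l β) (*-distribˡ-sum μ (λ i → 𝟙 (i ≟ᶠ j) * β i)) ⟨
    l * sum β + μ * sum (λ i → 𝟙 (i ≟ᶠ j) * β i)          ≡⟨ cong (λ s → l * sum β + μ * s) (∑-δ j β) ⟩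
    l * sum β + μ * β j                                   ∎
    where
    open ≡-Reasoning
    spread : ∀ b d → b * (l + d * μ) ≡ l * b + μ * (d * b)
    spread b d = spread′ l μ b d
      where
      spread′ : ∀ l μ b d → b * (l + d * μ) ≡ l * b + μ * (d * b)
      spread′ = solve-∀

  gram : ∀ α β → ⟨ load α , load β ⟩ ≡ l * (sum α * sum β) + μ * ⟨ α , β ⟩
  gram α β = begin
    ⟨ load α , load β ⟩                                   ≡⟨ ⟨load,⟩ α (load β) ⟩
    sum (λ i → α i * ⟨ e i , load β ⟩)                    ≡⟨ sum-cong-≗ (λ i → trans (cong (α i *_) (⟨e,load⟩ i β))
                                                                                   (spread (α i) (β i))) ⟩
    sum (λ i → (l * sum β) * α i + μ * (α i * β i))       ≡⟨ ∑-distrib-+ (λ i → (l * sum β) * α i) (λ i → μ * (α i * β i)) ⟩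
    sum (λ i → (l * sum β) * α i) + sum (λ i → μ * (α i * β i))
                                                          ≡⟨ cong₂ _+_ (*-distribˡ-sum (l * sum β) α)
                                                                       (*-distribˡ-sum μ (λ i → α i * β i)) ⟨
    (l * sum β) * sum α + μ * ⟨ α , β ⟩                   ≡⟨ cong (_+ μ * ⟨ α , β ⟩) (rearrange l (sum β) (sum α)) ⟩
    l * (sum α * sum β) + μ * ⟨ α , β ⟩                   ∎
    where
    open ≡-Reasoning
    spread : ∀ a b → a * (l * sum β + μ * b) ≡ (l * sum β) * a + μ * (a * b)
    spread a b = spread′ l μ (sum β) a b
      where
      spread′ : ∀ l μ s a b → a * (l * s + μ * b) ≡ (l * s) * a + μ * (a * b)
      spread′ = solve-∀
    rearrange : ∀ l s t → (l * s) * t ≡ l * (t * s)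
    rearrange = solve-∀

χ : ∀ {n} → Subset n → Fin n → ℕ
χ p x = 𝟙 (x ∈? p)

module _ {n} (p : Subset n) (x : Fin n) where

  χ-idem : χ p x * χ p x ≡ χ p x
  χ-idem = 𝟙-idem (x ∈? p)

  χ-∈ : x ∈ p → χ p x ≡ 1
  χ-∈ = 𝟙-yes (x ∈? p)

  χ-∉ : x ∉ p → χ p x ≡ 0
  χ-∉ = 𝟙-no (x ∈? p)

  χ+χ∁≡1 : χ p x + χ (∁ p) x ≡ 1
  χ+χ∁≡1 with x ∈? p
  ... | yes x∈p = cong (1 +_) (𝟙-no (x ∈? ∁ p) (x∈p⇒x∉∁p x∈p))
  ... | no  x∉p = 𝟙-yes (x ∈? ∁ p) (x∉p⇒x∈∁p x∉p)

  χ*χ∁≡0 : χ p x * χ (∁ p) x ≡ 0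
  χ*χ∁≡0 with x ∈? p
  ... | yes x∈p = cong (1 *_) (𝟙-no (x ∈? ∁ p) (x∈p⇒x∉∁p x∈p))
  ... | no  _   = refl

  χ-∩ : ∀ q → χ (p ∩ q) x ≡ χ p x * χ q x
  χ-∩ q with x ∈? p | x ∈? q
  ... | yes x∈p | yes x∈q = 𝟙-yes (x ∈? p ∩ q) (x∈p∩q⁺ (x∈p , x∈q))
  ... | yes _   | no  x∉q = 𝟙-no (x ∈? p ∩ q) (x∉q ∘ proj₂ ∘ x∈p∩q⁻ p q)
  ... | no  x∉p | _       = 𝟙-no (x ∈? p ∩ q) (x∉p ∘ proj₁ ∘ x∈p∩q⁻ p q)

∣p∣≡∑χ : ∀ {n} (p : Subset n) → ∣ p ∣ ≡ sum (χ p)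
∣p∣≡∑χ Vec.[]             = refl
∣p∣≡∑χ (true  Vec.∷ p) = cong suc (∣p∣≡∑χ p)
∣p∣≡∑χ (false Vec.∷ p) = ∣p∣≡∑χ p

∣p∩q∣≡⟨χ,χ⟩ : ∀ {n} (p q : Subset n) → ∣ p ∩ q ∣ ≡ ⟨ χ p , χ q ⟩
∣p∩q∣≡⟨χ,χ⟩ p q = trans (∣p∣≡∑χ (p ∩ q)) (sum-cong-≗ (λ x → χ-∩ p x q))

⟨χ,⟩+⟨χ∁,⟩≡∑ : ∀ {n} (p : Subset n) (f : Fin n → ℕ) → ⟨ χ p , f ⟩ + ⟨ χ (∁ p) , f ⟩ ≡ sum f
⟨χ,⟩+⟨χ∁,⟩≡∑ p f = begin
  ⟨ χ p , f ⟩ + ⟨ χ (∁ p) , f ⟩             ≡⟨ ∑-distrib-+ (λ x → χ p x * f x) (λ x → χ (∁ p) x * f x) ⟨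
  sum (λ x → χ p x * f x + χ (∁ p) x * f x) ≡⟨ sum-cong-≗ (λ x → trans (sym (*-distribʳ-+ (f x) (χ p x) (χ (∁ p) x)))
                                                                   (cong (_* f x) (χ+χ∁≡1 p x))) ⟩
  sum (λ x → 1 * f x)                       ≡⟨ sum-cong-≗ (λ x → *-identityˡ (f x)) ⟩
  sum f                                     ∎
  where open ≡-Reasoning

∣p∩q∣+∣p∩∁q∣≡∣p∣ : ∀ {n} (p q : Subset n) → ∣ p ∩ q ∣ + ∣ p ∩ ∁ q ∣ ≡ ∣ p ∣
∣p∩q∣+∣p∩∁q∣≡∣p∣ p q = begin
  ∣ p ∩ q ∣ + ∣ p ∩ ∁ q ∣             ≡⟨ cong₂ _+_ (∣p∩q∣≡⟨χ,χ⟩ p q) (∣p∩q∣≡⟨χ,χ⟩ p (∁ q)) ⟩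
  ⟨ χ p , χ q ⟩ + ⟨ χ p , χ (∁ q) ⟩   ≡⟨ cong₂ _+_ (⟨⟩-comm (χ p) (χ q)) (⟨⟩-comm (χ p) (χ (∁ q))) ⟩
  ⟨ χ q , χ p ⟩ + ⟨ χ (∁ q) , χ p ⟩   ≡⟨ ⟨χ,⟩+⟨χ∁,⟩≡∑ q (χ p) ⟩
  sum (χ p)                           ≡⟨ ∣p∣≡∑χ p ⟨
  ∣ p ∣                               ∎
  where open ≡-Reasoning

⟨χ,⟩-const : ∀ {n} (p : Subset n) (f : Fin n → ℕ) c → (∀ x → x ∈ p → f x ≡ c) → ⟨ χ p , f ⟩ ≡ c * ∣ p ∣
⟨χ,⟩-const p f c f≡c = begin
  ⟨ χ p , f ⟩          ≡⟨ sum-cong-≗ on-p ⟩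
  sum (λ x → c * χ p x) ≡⟨ *-distribˡ-sum c (χ p) ⟨
  c * sum (χ p)         ≡⟨ cong (c *_) (∣p∣≡∑χ p) ⟨
  c * ∣ p ∣             ∎
  where
  open ≡-Reasoning
  on-p : ∀ x → χ p x * f x ≡ c * χ p x
  on-p x with x ∈? p
  ... | yes x∈p = trans (+-identityʳ (f x)) (trans (f≡c x x∈p) (sym (*-identityʳ c)))
  ... | no  _   = sym (*-zeroʳ c)

⟨χ,⟩-mono-≤ : ∀ {n} (q : Subset n) {f g : Fin n → ℕ} → (∀ x → x ∈ q → f x ≤ g x) → ⟨ χ q , f ⟩ ≤ ⟨ χ q , g ⟩
⟨χ,⟩-mono-≤ q {f} {g} f≤g = ∑-mono-≤ on-q
  where
  on-q : ∀ x → χ q x * f x ≤ χ q x * g x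
  on-q x with x ∈? q
  ... | yes x∈q = *-monoʳ-≤ 1 (f≤g x x∈q)
  ... | no  _   = z≤n

module _ {n} (p : Subset n) (a b : ℕ) where

  piecewise : Fin n → ℕ
  piecewise x = a * χ p x + b * χ (∁ p) x

  piecewise-∈ : ∀ {x} → x ∈ p → piecewise x ≡ a
  piecewise-∈ {x} x∈p rewrite χ-∈ p x x∈p | χ-∉ (∁ p) x (x∈p⇒x∉∁p x∈p) =
    trans (cong₂ _+_ (*-identityʳ a) (*-zeroʳ b)) (+-identityʳ a)

  piecewise-∉ : ∀ {x} → x ∉ p → piecewise x ≡ b
  piecewise-∉ {x} x∉p rewrite χ-∉ p x x∉p | χ-∈ (∁ p) x (x∉p⇒x∈∁p x∉p) =
    trans (cong (a * 0 +_) (*-identityʳ b)) (cong (_+ b) (*-zeroʳ a))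

  ⟨χ,piecewise⟩ : ∀ q → ⟨ χ q , piecewise ⟩ ≡ a * ∣ q ∩ p ∣ + b * ∣ q ∩ ∁ p ∣
  ⟨χ,piecewise⟩ q = begin
    ⟨ χ q , piecewise ⟩                               ≡⟨ ⟨,+⟩ (χ q) (λ x → a * χ p x) (λ x → b * χ (∁ p) x) ⟩
    ⟨ χ q , (λ x → a * χ p x) ⟩ + ⟨ χ q , (λ x → b * χ (∁ p) x) ⟩
                                                      ≡⟨ cong₂ _+_ (⟨,*⟩ a (χ q) (χ p)) (⟨,*⟩ b (χ q) (χ (∁ p))) ⟩
    a * ⟨ χ q , χ p ⟩ + b * ⟨ χ q , χ (∁ p) ⟩         ≡⟨ cong₂ (λ u w → a * u + b * w) (∣p∩q∣≡⟨χ,χ⟩ q p) (∣p∩q∣≡⟨χ,χ⟩ q (∁ p)) ⟨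
    a * ∣ q ∩ p ∣ + b * ∣ q ∩ ∁ p ∣                   ∎
    where open ≡-Reasoning

  module _ (q : Subset n) (f : Fin n → ℕ) where

    ⟨χ,⟩-≤-piecewise : (∀ x → x ∈ q → x ∈ p → f x ≤ a) → (∀ x → x ∈ q → x ∉ p → f x ≤ b) →
                       ⟨ χ q , f ⟩ ≤ a * ∣ q ∩ p ∣ + b * ∣ q ∩ ∁ p ∣
    ⟨χ,⟩-≤-piecewise on-p off-p = ≤-trans (⟨χ,⟩-mono-≤ q bound) (≤-reflexive (⟨χ,piecewise⟩ q))
      where
      bound : ∀ x → x ∈ q → f x ≤ piecewise x
      bound x x∈q with toSum (x ∈? p)
      ... | inj₁ x∈p = ≤-trans (on-p x x∈q x∈p) (≤-reflexive (sym (piecewise-∈ x∈p)))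
      ... | inj₂ x∉p = ≤-trans (off-p x x∈q x∉p) (≤-reflexive (sym (piecewise-∉ x∉p)))

    ⟨χ,⟩-≥-piecewise : (∀ x → x ∈ q → x ∈ p → a ≤ f x) → (∀ x → x ∈ q → x ∉ p → b ≤ f x) →
                       a * ∣ q ∩ p ∣ + b * ∣ q ∩ ∁ p ∣ ≤ ⟨ χ q , f ⟩
    ⟨χ,⟩-≥-piecewise on-p off-p = ≤-trans (≤-reflexive (sym (⟨χ,piecewise⟩ q))) (⟨χ,⟩-mono-≤ q bound)
      where
      bound : ∀ x → x ∈ q → piecewise x ≤ f x
      bound x x∈q with toSum (x ∈? p)
      ... | inj₁ x∈p = ≤-trans (≤-reflexive (piecewise-∈ x∈p)) (on-p x x∈q x∈p)
      ... | inj₂ x∉p = ≤-trans (≤-reflexive (piecewise-∉ x∉p)) (off-p x x∈q x∉p)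

p⊆q⇒∣q∣≤∣p∣⇒p≡q : ∀ {n} {p q : Subset n} → p ⊆ q → ∣ q ∣ ≤ ∣ p ∣ → p ≡ q
p⊆q⇒∣q∣≤∣p∣⇒p≡q {p = p} {q} p⊆q ∣q∣≤∣p∣ = ⊆-antisym p⊆q q⊆p
  where
  q⊆p : q ⊆ p
  q⊆p {x} x∈q with x ∈? p
  ... | yes x∈p = x∈p
  ... | no  x∉p = contradiction (p⊂q⇒∣p∣<∣q∣ (p⊆q , x , x∈q , x∉p)) (≤⇒≯ ∣q∣≤∣p∣)

module _ {ℓ n} {P : Pred (Fin n) ℓ} (P? : Decidable P) where

  toSubset : Subset n
  toSubset = Vec.tabulate (does ∘ P?)

  ∈-toSubset⁺ : ∀ {x} → P x → x ∈ toSubset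
  ∈-toSubset⁺ {x} Px = lookup⇒[]= x toSubset (trans (lookup∘tabulate (does ∘ P?) x) (dec-true (P? x) Px))

  ∈-toSubset⁻ : ∀ {x} → x ∈ toSubset → P x
  ∈-toSubset⁻ {x} x∈ with P? x | trans (sym (lookup∘tabulate (does ∘ P?) x)) ([]=⇒lookup x∈)
  ... | yes Px | _ = Px
  ... | no  _  | ()

x∈⋂⁺ : ∀ {n} {x : Fin n} {ps : List (Subset n)} → All (x ∈_) ps → x ∈ ⋂ ps
x∈⋂⁺ []            = ∈⊤
x∈⋂⁺ (x∈p ∷ x∈ps) = x∈p∩q⁺ (x∈p , x∈⋂⁺ x∈ps)

x∈⋂⁻ : ∀ {n} {x : Fin n} (ps : List (Subset n)) → x ∈ ⋂ ps → All (x ∈_) ps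
x∈⋂⁻ []       _      = []
x∈⋂⁻ (p ∷ ps) x∈p∩⋂ = proj₁ (x∈p∩q⁻ p (⋂ ps) x∈p∩⋂) ∷ x∈⋂⁻ ps (proj₂ (x∈p∩q⁻ p (⋂ ps) x∈p∩⋂))

kernel⊆ : ∀ {n m} (E : Hypergraph n m) i → kernel E ⊆ E i
kernel⊆ {m = m} E i x∈ = All.tabulate⁻ (All.map⁻ (x∈⋂⁻ (map E (allFin m)) x∈)) i

⊆kernel : ∀ {n m} (E : Hypergraph n m) {p} → (∀ i → p ⊆ E i) → p ⊆ kernel E
⊆kernel E p⊆E x∈p = x∈⋂⁺ (All.map⁺ (All.tabulate⁺ (λ i → p⊆E i x∈p)))

-- λ-intersecting uniform hypergraphs

module IntersectingUniform {n m} (l μ : ℕ) (E : Hypergraph n m)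
                 (uniform : ∀ i → ∣ E i ∣ ≡ l + μ) (intersecting : Intersecting l E) where

  e : Fin m → Fin n → ℕ
  e i = χ (E i)

  ⟨e,e⟩ : ∀ i j → ⟨ e i , e j ⟩ ≡ l + 𝟙 (i ≟ᶠ j) * μ
  ⟨e,e⟩ i j with i ≟ᶠ j
  ... | yes refl = begin
    ⟨ e i , e i ⟩   ≡⟨ ∣p∩q∣≡⟨χ,χ⟩ (E i) (E i) ⟨
    ∣ E i ∩ E i ∣   ≡⟨ cong ∣_∣ (∩-idem (E i)) ⟩
    ∣ E i ∣         ≡⟨ uniform i ⟩
    l + μ           ≡⟨ cong (l +_) (+-identityʳ μ) ⟨
    l + 1 * μ       ∎
    where open ≡-Reasoning
  ... | no  i≢j = trans (sym (∣p∩q∣≡⟨χ,χ⟩ (E i) (E j))) (trans (intersecting i j i≢j) (sym (+-identityʳ l)))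

  open Gram l μ e ⟨e,e⟩ public

  d d̄ : Fin n → ℕ
  d  x = ∑[ i < m ] χ (E i) x
  d̄ x = ∑[ i < m ] χ (∁ (E i)) x

  degree≡d : ∀ x → degree E x ≡ d x
  degree≡d x = length-filter-tabulate (λ i → x ∈? E i) (λ i → i)

  load-1≡d : ∀ x → load (λ _ → 1) x ≡ d x
  load-1≡d x = sum-cong-≗ (λ i → *-identityˡ (e i x))

  d+d̄≡m : ∀ x → d x + d̄ x ≡ m
  d+d̄≡m x = begin
    d x + d̄ x                                   ≡⟨ ∑-distrib-+ (λ i → χ (E i) x) (λ i → χ (∁ (E i)) x) ⟨
    ∑[ i < m ] (χ (E i) x + χ (∁ (E i)) x)      ≡⟨ sum-cong-≗ (λ i → χ+χ∁≡1 (E i) x) ⟩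
    ∑[ i < m ] 1                                ≡⟨ trans (∑-const {m} 1) (*-identityʳ m) ⟩
    m                                           ∎
    where open ≡-Reasoning

  d≤m : ∀ x → d x ≤ m
  d≤m x = subst (d x ≤_) (d+d̄≡m x) (m≤m+n (d x) (d̄ x))

  1≤d : ∀ {i x} → x ∈ E i → 1 ≤ d x
  1≤d {i} {x} x∈Eᵢ = subst (_≤ d x) (χ-∈ (E i) x x∈Eᵢ) (term≤∑ (λ j → χ (E j) x) i)

  -- For u = d̄ v · load in-v − d v · load out-v the Gram identity gives ‖u‖² = μ m (d v) (d̄ v),
  -- while u v = (d v) (d̄ v).
  d*d̄≤μ*m : ∀ v → d v * d̄ v ≤ μ * m
  d*d̄≤μ*m v = subst (λ k → d v * d̄ v ≤ μ * k) (d+d̄≡m v) (a*b≤μ*[a+b] l μ (d v) (d̄ v) (begin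
    2 * (d̄ v * d v) * (l * (d v * d̄ v)) + (d̄ v * d v) * (d̄ v * d v)
      ≡⟨ cong₂ (λ u w → 2 * (d̄ v * d v) * u + (d̄ v * w) * (d̄ v * w)) (sym ⟨load-in,load-out⟩) (sym load-in-v) ⟩
    2 * (d̄ v * d v) * ⟨ load in-v , load out-v ⟩ + (d̄ v * load in-v v) * (d̄ v * load in-v v)
      ≤⟨ ⟨⟩-cross-term (d̄ v) (d v) (load in-v) (load out-v) v load-out-v ⟩
    (d̄ v * d̄ v) * ⟨ load in-v , load in-v ⟩ + (d v * d v) * ⟨ load out-v , load out-v ⟩
      ≡⟨ cong₂ (λ u w → (d̄ v * d̄ v) * u + (d v * d v) * w) ⟨load-in,load-in⟩ ⟨load-out,load-out⟩ ⟩
    (d̄ v * d̄ v) * (l * (d v * d v) + μ * d v) + (d v * d v) * (l * (d̄ v * d̄ v) + μ * d̄ v) ∎))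
    where
    open ≤-Reasoning
    in-v out-v : Fin m → ℕ
    in-v  i = χ (E i) v
    out-v i = χ (∁ (E i)) v
    ⟨in,in⟩ : ⟨ in-v , in-v ⟩ ≡ d v
    ⟨in,in⟩ = sum-cong-≗ (λ i → χ-idem (E i) v)
    ⟨out,out⟩ : ⟨ out-v , out-v ⟩ ≡ d̄ v
    ⟨out,out⟩ = sum-cong-≗ (λ i → χ-idem (∁ (E i)) v)
    ⟨in,out⟩ : ⟨ in-v , out-v ⟩ ≡ 0
    ⟨in,out⟩ = trans (sum-cong-≗ (λ i → χ*χ∁≡0 (E i) v)) (trans (∑-const {m} 0) (*-zeroʳ m))
    load-in-v : load in-v v ≡ d v
    load-in-v = ⟨in,in⟩
    load-out-v : load out-v v ≡ 0
    load-out-v = trans (⟨⟩-comm out-v in-v) ⟨in,out⟩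
    ⟨load-in,load-out⟩ : ⟨ load in-v , load out-v ⟩ ≡ l * (d v * d̄ v)
    ⟨load-in,load-out⟩ = trans (gram in-v out-v)
      (trans (cong (λ k → l * (d v * d̄ v) + μ * k) ⟨in,out⟩) (trans (cong (l * (d v * d̄ v) +_) (*-zeroʳ μ)) (+-identityʳ _)))
    ⟨load-in,load-in⟩ : ⟨ load in-v , load in-v ⟩ ≡ l * (d v * d v) + μ * d v
    ⟨load-in,load-in⟩ = trans (gram in-v in-v) (cong (λ k → l * (d v * d v) + μ * k) ⟨in,in⟩)
    ⟨load-out,load-out⟩ : ⟨ load out-v , load out-v ⟩ ≡ l * (d̄ v * d̄ v) + μ * d̄ v
    ⟨load-out,load-out⟩ = trans (gram out-v out-v) (cong (λ k → l * (d̄ v * d̄ v) + μ * k) ⟨out,out⟩)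

  ⟨e,d⟩ : ∀ j → ⟨ e j , d ⟩ ≡ l * m + μ
  ⟨e,d⟩ j = begin
    ⟨ e j , d ⟩                   ≡⟨ sum-cong-≗ (λ x → cong (e j x *_) (load-1≡d x)) ⟨
    ⟨ e j , load (λ _ → 1) ⟩      ≡⟨ ⟨e,load⟩ j (λ _ → 1) ⟩
    l * ∑[ i < m ] 1 + μ * 1      ≡⟨ cong₂ (λ s t → l * s + t) (trans (∑-const {m} 1) (*-identityʳ m)) (*-identityʳ μ) ⟩
    l * m + μ                     ∎
    where open ≡-Reasoning

  heavy? : Decidable (Heavy μ E)
  heavy? v = 10 * m ≤? 10 * degree E v + 11 * μ

  H : Subset n
  H = toSubset heavy?

  numHeavy≡∣H∣ : numHeavy μ E ≡ ∣ H ∣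
  numHeavy≡∣H∣ = trans (length-filter-tabulate heavy? (λ v → v))
                       (trans (sum-cong-≗ (λ v → 𝟙-cong (heavy? v) (v ∈? H) (mk⇔ (∈-toSubset⁺ heavy?) (∈-toSubset⁻ heavy?))))
                              (sym (∣p∣≡∑χ H)))

  heavy-degree : ∀ x → x ∈ H → 10 * m ≤ 10 * d x + 11 * μ
  heavy-degree x x∈H = subst (λ k → 10 * m ≤ 10 * k + 11 * μ) (degree≡d x) (∈-toSubset⁻ heavy? x∈H)

  light-degree : 20 * μ ≤ m → ∀ x → x ∉ H → 10 * d x ≤ 11 * μ
  light-degree 20μ≤m x x∉H = light-degree-bound μ m (d x) (d̄ x) (d+d̄≡m x) (d*d̄≤μ*m x) 20μ≤m
    (≰⇒> (x∉H ∘ ∈-toSubset⁺ heavy? ∘ subst (λ k → 10 * m ≤ 10 * k + 11 * μ) (sym (degree≡d x))))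

  c c' : Fin m → ℕ
  c  j = ∣ E j ∩ H ∣
  c' j = ∣ E j ∩ ∁ H ∣

  c+c'≡l+μ : ∀ j → c j + c' j ≡ l + μ
  c+c'≡l+μ j = trans (∣p∩q∣+∣p∩∁q∣≡∣p∣ (E j) H) (uniform j)

  few-heavy : 20 * μ ≤ m → 1 ≤ μ → Fin m → ∣ H ∣ < l → m ≤ 2 * (μ * μ)
  few-heavy 20μ≤m 1≤μ j h<l =
    few-heavy-bound (c j) (c' j) l μ m (c+c'≡l+μ j) (≤-<-trans (∣p∩q∣≤∣q∣ (E j) H) h<l) 1≤μ (begin
      10 * (l * m + μ)              ≡⟨ cong (10 *_) (⟨e,d⟩ j) ⟨
      10 * ⟨ e j , d ⟩              ≡⟨ ⟨,*⟩ 10 (e j) d ⟨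
      ⟨ e j , (λ x → 10 * d x) ⟩    ≤⟨ ⟨χ,⟩-≤-piecewise H (10 * m) (11 * μ) (E j) (λ x → 10 * d x)
                                         (λ x _ _ → *-monoʳ-≤ 10 (d≤m x)) (λ x _ x∉H → light-degree 20μ≤m x x∉H) ⟩
      10 * m * c j + 11 * μ * c' j  ∎)
    where open ≤-Reasoning

  module ManyHeavy (1≤l : 1 ≤ l) (1≤μ : 1 ≤ μ) (3lμ<m : 3 * (l * μ) < m) (l≤∣H∣ : l ≤ ∣ H ∣) where

    weighted-degree : Fin n → ℕ
    weighted-degree x = 10 * d x + 11 * μ * χ H x

    10m≤weighted-degree : ∀ x → x ∈ H → 10 * m ≤ weighted-degree x
    10m≤weighted-degree x x∈H = begin
      10 * m                    ≤⟨ heavy-degree x x∈H ⟩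
      10 * d x + 11 * μ         ≡⟨ cong (10 * d x +_) (*-identityʳ (11 * μ)) ⟨
      10 * d x + 11 * μ * 1     ≡⟨ cong (λ k → 10 * d x + 11 * μ * k) (χ-∈ H x x∈H) ⟨
      weighted-degree x                       ∎
      where open ≤-Reasoning

    ⟨χ,weighted-degree⟩ : ∀ q → ⟨ χ q , weighted-degree ⟩ ≡ 10 * ⟨ χ q , d ⟩ + 11 * μ * ∣ q ∩ H ∣
    ⟨χ,weighted-degree⟩ q = trans (⟨,+⟩ (χ q) (λ x → 10 * d x) (λ x → 11 * μ * χ H x))
                    (cong₂ _+_ (⟨,*⟩ 10 (χ q) d)
                               (trans (⟨,*⟩ (11 * μ) (χ q) (χ H)) (cong (11 * μ *_) (sym (∣p∩q∣≡⟨χ,χ⟩ q H)))))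

    c≤l : ∀ j → c j ≤ l
    c≤l j = heavy-per-edge-bound (c j) (c' j) l μ m (c+c'≡l+μ j) 1≤l 3lμ<m (begin
      10 * m * c j + 10 * c' j        ≤⟨ ⟨χ,⟩-≥-piecewise H (10 * m) 10 (E j) weighted-degree (λ x _ x∈H → 10m≤weighted-degree x x∈H)
                                           (λ x x∈Eⱼ _ → ≤-trans (*-monoʳ-≤ 10 (1≤d x∈Eⱼ)) (m≤m+n (10 * d x) _)) ⟩
      ⟨ e j , weighted-degree ⟩                     ≡⟨ ⟨χ,weighted-degree⟩ (E j) ⟩
      10 * ⟨ e j , d ⟩ + 11 * μ * c j ≡⟨ cong (λ s → 10 * s + 11 * μ * c j) (⟨e,d⟩ j) ⟩
      10 * (l * m + μ) + 11 * μ * c j ∎)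
      where open ≤-Reasoning

    S : ℕ
    S = ⟨ χ H , d ⟩

    S≡∑c : S ≡ ∑[ j < m ] c j
    S≡∑c = begin
      ⟨ χ H , d ⟩                           ≡⟨ sum-cong-≗ (λ x → cong (χ H x *_) (load-1≡d x)) ⟨
      ⟨ χ H , load (λ _ → 1) ⟩              ≡⟨ ⟨⟩-comm (χ H) (load (λ _ → 1)) ⟩
      ⟨ load (λ _ → 1) , χ H ⟩              ≡⟨ ⟨load,⟩ (λ _ → 1) (χ H) ⟩
      ∑[ j < m ] (1 * ⟨ e j , χ H ⟩)        ≡⟨ sum-cong-≗ (λ j → trans (*-identityˡ _) (sym (∣p∩q∣≡⟨χ,χ⟩ (E j) H))) ⟩
      ∑[ j < m ] c j                        ∎
      where open ≡-Reasoning

    10m∣H∣≤10S+11μ∣H∣ : 10 * m * ∣ H ∣ ≤ 10 * S + 11 * μ * ∣ H ∣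
    10m∣H∣≤10S+11μ∣H∣ = begin
      10 * m * ∣ H ∣                              ≡⟨ cong (λ p → 10 * m * ∣ p ∣) (∩-idem H) ⟨
      10 * m * ∣ H ∩ H ∣                          ≤⟨ m≤m+n _ 0 ⟩
      10 * m * ∣ H ∩ H ∣ + 0 * ∣ H ∩ ∁ H ∣        ≤⟨ ⟨χ,⟩-≥-piecewise H (10 * m) 0 H weighted-degree (λ x _ x∈H → 10m≤weighted-degree x x∈H) (λ _ _ _ → z≤n) ⟩
      ⟨ χ H , weighted-degree ⟩                                 ≡⟨ ⟨χ,weighted-degree⟩ H ⟩
      10 * S + 11 * μ * ∣ H ∩ H ∣                 ≡⟨ cong (λ p → 10 * S + 11 * μ * ∣ p ∣) (∩-idem H) ⟩
      10 * S + 11 * μ * ∣ H ∣                     ∎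
      where open ≤-Reasoning

    ∣H∣≡l : ∣ H ∣ ≡ l
    ∣H∣≡l = ≤-antisym (heavy-count-bound ∣ H ∣ l μ m S S≤ml 10m∣H∣≤10S+11μ∣H∣ 3lμ<m 1≤l) l≤∣H∣
      where
      S≤ml : S ≤ m * l
      S≤ml = ≤-trans (≤-reflexive S≡∑c) (≤-trans (∑-mono-≤ c≤l) (≤-reflexive (∑-const {m} l)))

    full : Fin m → ℕ
    full j = 𝟙 (H ⊆? E j)

    t : ℕ
    t = sum full

    not-full⇒c<l : ∀ j → ¬ H ⊆ E j → c j < l
    not-full⇒c<l j H⊈Eⱼ = subst (c j <_) ∣H∣≡l (≰⇒> λ ∣H∣≤c → H⊈Eⱼ (λ x∈H →
      p∩q⊆p (E j) H (subst (_ ∈_) (sym (p⊆q⇒∣q∣≤∣p∣⇒p≡q (p∩q⊆q (E j) H) ∣H∣≤c)) x∈H)))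

    1+c≤l+full : ∀ j → suc (c j) ≤ l + full j
    1+c≤l+full j with H ⊆? E j
    ... | yes _    = subst (suc (c j) ≤_) (+-comm 1 l) (s≤s (c≤l j))
    ... | no H⊈Eⱼ = ≤-trans (not-full⇒c<l j H⊈Eⱼ) (m≤m+n l 0)

    10m≤10t+11μl : 10 * m ≤ 10 * t + 11 * μ * l
    10m≤10t+11μl = full-edges-bound m l S t μ (subst (λ h → 10 * m * h ≤ 10 * S + 11 * μ * h) ∣H∣≡l 10m∣H∣≤10S+11μ∣H∣)
      (begin
        m + S                                  ≡⟨ cong₂ _+_ (sym (trans (∑-const {m} 1) (*-identityʳ m))) S≡∑c ⟩
        ∑[ j < m ] 1 + ∑[ j < m ] c j          ≡⟨ ∑-distrib-+ (λ _ → 1) c ⟨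
        ∑[ j < m ] suc (c j)                   ≤⟨ ∑-mono-≤ 1+c≤l+full ⟩
        ∑[ j < m ] (l + full j)                ≡⟨ ∑-distrib-+ (λ _ → l) full ⟩
        ∑[ j < m ] l + t                       ≡⟨ cong (_+ t) (∑-const {m} l) ⟩
        m * l + t                              ∎)
      where open ≤-Reasoning

    W : Fin n → ℕ
    W = load full

    W-on-H : ∀ x → x ∈ H → W x ≡ t
    W-on-H x x∈H = sum-cong-≗ through-x
      where
      through-x : ∀ j → full j * e j x ≡ full j
      through-x j with H ⊆? E j
      ... | yes H⊆Eⱼ = trans (*-identityˡ (e j x)) (χ-∈ (E j) x (H⊆Eⱼ x∈H))
      ... | no  _    = refl

    ⟨χH,W⟩ : ⟨ χ H , W ⟩ ≡ t * l
    ⟨χH,W⟩ = trans (⟨χ,⟩-const H W t W-on-H) (cong (t *_) ∣H∣≡l)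

    ⟨χH,W²⟩ : ⟨ χ H , (λ x → W x * W x) ⟩ ≡ (t * t) * l
    ⟨χH,W²⟩ = trans (⟨χ,⟩-const H (λ x → W x * W x) (t * t) (λ x x∈H → cong₂ _*_ (W-on-H x x∈H) (W-on-H x x∈H)))
                    (cong (t * t *_) ∣H∣≡l)

    ∑W : sum W ≡ t * l + μ * t
    ∑W = begin
      sum W                                ≡⟨ sum-load full ⟩
      ∑[ j < m ] (full j * sum (e j))      ≡⟨ sum-cong-≗ (λ j → cong (full j *_) (trans (sym (∣p∣≡∑χ (E j))) (uniform j))) ⟩
      ∑[ j < m ] (full j * (l + μ))        ≡⟨ *-distribʳ-sum (l + μ) full ⟨
      t * (l + μ)                          ≡⟨ trans (*-distribˡ-+ t l μ) (cong (t * l +_) (*-comm t μ)) ⟩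
      t * l + μ * t                        ∎
      where open ≡-Reasoning

    ∑W² : sum (λ x → W x * W x) ≡ (t * t) * l + μ * t
    ∑W² = trans (gram full full) (cong₂ (λ u k → u + μ * k) (*-comm l (t * t)) (sum-cong-≗ (λ j → 𝟙-idem (H ⊆? E j))))

    -- Off H the Gram identity for the full edges gives ∑ W = ∑ W², which forces W ∈ {0, 1} there.
    W-off-H≤1 : ∀ x → x ∉ H → W x ≤ 1
    W-off-H≤1 x x∉H = n≡n*n⇒n≤1 (W x) (begin-equality
      W x                              ≡⟨ *-identityˡ (W x) ⟨
      1 * W x                          ≡⟨ cong (_* W x) (χ-∈ (∁ H) x x∈∁H) ⟨
      χ (∁ H) x * W x                  ≡⟨ ∑-tight (λ y → *-monoʳ-≤ (χ (∁ H) y) (n≤n*n (W y)))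
                                                   (≤-reflexive (trans ⟨χ∁H,W²⟩ (sym ⟨χ∁H,W⟩))) x ⟩
      χ (∁ H) x * (W x * W x)          ≡⟨ cong (_* (W x * W x)) (χ-∈ (∁ H) x x∈∁H) ⟩
      1 * (W x * W x)                  ≡⟨ *-identityˡ (W x * W x) ⟩
      W x * W x                        ∎)
      where
      open ≤-Reasoning
      x∈∁H : x ∈ ∁ H
      x∈∁H = x∉p⇒x∈∁p x∉H
      ⟨χ∁H,W⟩ : ⟨ χ (∁ H) , W ⟩ ≡ μ * t
      ⟨χ∁H,W⟩ = +-cancelˡ-≡ (t * l) _ _ (begin-equality
        t * l + ⟨ χ (∁ H) , W ⟩             ≡⟨ cong (_+ ⟨ χ (∁ H) , W ⟩) ⟨χH,W⟩ ⟨
        ⟨ χ H , W ⟩ + ⟨ χ (∁ H) , W ⟩       ≡⟨ ⟨χ,⟩+⟨χ∁,⟩≡∑ H W ⟩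
        sum W                               ≡⟨ ∑W ⟩
        t * l + μ * t                       ∎)
      ⟨χ∁H,W²⟩ : ⟨ χ (∁ H) , (λ y → W y * W y) ⟩ ≡ μ * t
      ⟨χ∁H,W²⟩ = +-cancelˡ-≡ ((t * t) * l) _ _ (begin-equality
        (t * t) * l + ⟨ χ (∁ H) , (λ y → W y * W y) ⟩                 ≡⟨ cong (_+ ⟨ χ (∁ H) , (λ y → W y * W y) ⟩) ⟨χH,W²⟩ ⟨
        ⟨ χ H , (λ y → W y * W y) ⟩ + ⟨ χ (∁ H) , (λ y → W y * W y) ⟩ ≡⟨ ⟨χ,⟩+⟨χ∁,⟩≡∑ H (λ y → W y * W y) ⟩
        sum (λ y → W y * W y)                                         ≡⟨ ∑W² ⟩
        (t * t) * l + μ * t                                           ∎)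

    every-edge-full : ∀ j → H ⊆ E j
    every-edge-full j with H ⊆? E j
    ... | yes H⊆Eⱼ = H⊆Eⱼ
    ... | no  H⊈Eⱼ = ⊥-elim (full-edges-absurd l μ m t 10m≤10t+11μl t≤l+μ 3lμ<m 1≤l 1≤μ)
      where
      open ≤-Reasoning
      l*t≤t*c+c' : l * t ≤ t * c j + c' j
      l*t≤t*c+c' = begin
        l * t                        ≡⟨ trans (cong (λ k → l * t + μ * k) (𝟙-no (H ⊆? E j) H⊈Eⱼ))
                                              (trans (cong (l * t +_) (*-zeroʳ μ)) (+-identityʳ (l * t))) ⟨
        l * t + μ * full j           ≡⟨ ⟨e,load⟩ j full ⟨
        ⟨ e j , W ⟩                  ≤⟨ ⟨χ,⟩-≤-piecewise H t 1 (E j) W (λ x _ x∈H → ≤-reflexive (W-on-H x x∈H))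
                                                                        (λ x _ x∉H → W-off-H≤1 x x∉H) ⟩
        t * c j + 1 * c' j           ≡⟨ cong (t * c j +_) (*-identityˡ (c' j)) ⟩
        t * c j + c' j               ∎
      t≤l+μ : t ≤ l + μ
      t≤l+μ = begin
        t              ≤⟨ l*t≤t*c+c'⇒t≤c' l t (c j) (c' j) l*t≤t*c+c' (not-full⇒c<l j H⊈Eⱼ) ⟩
        c' j           ≤⟨ m≤n+m (c' j) (c j) ⟩
        c j + c' j     ≡⟨ c+c'≡l+μ j ⟩
        l + μ          ∎

    sunflower : IsSunflower E
    sunflower i j i≢j = trans (sym H≡Eᵢ∩Eⱼ) (⊆-antisym (⊆kernel E every-edge-full) kernel⊆H)
      where
      H≡Eᵢ∩Eⱼ : H ≡ E i ∩ E j
      H≡Eᵢ∩Eⱼ = p⊆q⇒∣q∣≤∣p∣⇒p≡q (λ x∈H → x∈p∩q⁺ (every-edge-full i x∈H , every-edge-full j x∈H))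
                                 (≤-reflexive (trans (intersecting i j i≢j) (sym ∣H∣≡l)))
      kernel⊆H : kernel E ⊆ H
      kernel⊆H x∈K = subst (_ ∈_) (sym H≡Eᵢ∩Eⱼ) (x∈p∩q⁺ (kernel⊆ E i x∈K , kernel⊆ E j x∈K))

  many-heavy : 1 ≤ l → 1 ≤ μ → l ≤ ∣ H ∣ → ¬ IsSunflower E → m ≤ 3 * (l * μ)
  many-heavy 1≤l 1≤μ l≤∣H∣ not-sunflower with m ≤? 3 * (l * μ)
  ... | yes m≤3lμ = m≤3lμ
  ... | no  m≰3lμ = contradiction (ManyHeavy.sunflower 1≤l 1≤μ (≰⇒> m≰3lμ) l≤∣H∣) not-sunflower

two-distinct-edges : ∀ {n m} {E : Hypergraph n m} → ¬ IsSunflower E → ∃₂ λ (i j : Fin m) → i ≢ j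
two-distinct-edges {m = zero}        not-sunflower = contradiction (λ ()) not-sunflower
two-distinct-edges {m = suc zero}    not-sunflower = contradiction (λ { zero zero 0≢0 → contradiction refl 0≢0 }) not-sunflower
two-distinct-edges {m = suc (suc m)} _             = zero , suc zero , λ ()

intersection-size<edge-size : ∀ {n m k l} {E : Hypergraph n m} → IsKGraph k E → Intersecting l E →
                              ∀ {i j} → i ≢ j → l < k
intersection-size<edge-size {k = k} {l} {E} (distinct , uniform) intersecting {i} {j} i≢j = ≤∧≢⇒< l≤k l≢k
  where
  ∣Eᵢ∩Eⱼ∣≡l : ∣ E i ∩ E j ∣ ≡ l
  ∣Eᵢ∩Eⱼ∣≡l = intersecting i j i≢j
  l≤k : l ≤ k
  l≤k = subst₂ _≤_ ∣Eᵢ∩Eⱼ∣≡l (uniform i) (∣p∩q∣≤∣p∣ (E i) (E j))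
  l≢k : l ≢ k
  l≢k l≡k = i≢j (distinct (trans (sym (Eᵢ∩Eⱼ≡ (p∩q⊆p (E i) (E j)) (uniform i))) (Eᵢ∩Eⱼ≡ (p∩q⊆q (E i) (E j)) (uniform j))))
    where
    Eᵢ∩Eⱼ≡ : ∀ {p} → E i ∩ E j ⊆ p → ∣ p ∣ ≡ k → E i ∩ E j ≡ p
    Eᵢ∩Eⱼ≡ Eᵢ∩Eⱼ⊆p ∣p∣≡k = p⊆q⇒∣q∣≤∣p∣⇒p≡q Eᵢ∩Eⱼ⊆p (≤-reflexive (trans ∣p∣≡k (sym (trans ∣Eᵢ∩Eⱼ∣≡l l≡k))))

lemma4p6 : (k l n m : ℕ) → .{{_ : NonZero k}} → .{{_ : NonZero l}} →
    (E : Hypergraph n m) → IsKGraph k E → Intersecting l E →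
    20 * (k ∸ l) ≤ m → ¬ IsSunflower E →
    (numHeavy (k ∸ l) E < l → m ≤ 2 * ((k ∸ l) * (k ∸ l))) ×
    (¬ (numHeavy (k ∸ l) E < l) → m ≤ 3 * (l * (k ∸ l)))
lemma4p6 k l n m E k-graph@(_ , uniform) intersecting 20μ≤m not-sunflower
  with two-distinct-edges not-sunflower
... | i , _ , i≢j = few-heavy-case , many-heavy-case
  where
  l<k : l < k
  l<k = intersection-size<edge-size k-graph intersecting i≢j
  1≤μ : 1 ≤ k ∸ l
  1≤μ = m<n⇒0<n∸m l<k
  open IntersectingUniform l (k ∸ l) E (λ j → trans (uniform j) (sym (m+[n∸m]≡n (<⇒≤ l<k)))) intersecting
  few-heavy-case : numHeavy (k ∸ l) E < l → m ≤ 2 * ((k ∸ l) * (k ∸ l))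
  few-heavy-case h<l = few-heavy 20μ≤m 1≤μ i (subst (_< l) numHeavy≡∣H∣ h<l)
  many-heavy-case : ¬ (numHeavy (k ∸ l) E < l) → m ≤ 3 * (l * (k ∸ l))
  many-heavy-case h≮l = many-heavy (>-nonZero⁻¹ l) 1≤μ (subst (l ≤_) numHeavy≡∣H∣ (≮⇒≥ h≮l)) not-sunflower
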